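{- Let $\lambda$ and $\nu$ be finite sequences of positive integers and let $\mu$ be a partition. Let $N$ be an integer with $N\geq \ell(\lambda)$ and $N\ge\ell(\nu)$ (where $\ell$ denotes the number of entries), and regard $\lambda,\nu$ as vectors of length $N$ by appending zeros. Then $b_{\lambda,\mu}^{\nu}$ equals the cardinality of the set $Q(\lambda,\mu,\nu,N)$ of matrices $\mathcal{M}=(m_{i,T})$ with non-negative integer entries, whose rows are indexed by $i\in\{1,\dots,N\}$ and whose columns are indexed by the tableaux $T\in t(\mu,N)$, such that: (1) for each $i$, the sum of the entries of the $i$-th row of $\mathcal{M}$ is $\lambda_i$; (2) for each $j\in\{1,\dots,N\}$, the sum of the entries of the $j$-th column of the matrix product $\mathcal{M}\mathcal{P}_{\mu,N}$ is $\nu_j$, i.e. $\sum_{i,T} m_{i,T}\,\rho_j(T) = \nu_j$.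
   Context: For a finite sequence of integers $\alpha=(\alpha_1,\dots,\alpha_k)$, $h_\alpha=h_{\alpha_1}\cdots h_{\alpha_k}$ where $h_r$ is the complete homogeneous symmetric function ($h_0=1$, $h_r=0$ for $r<0$). For a partition $\mu$ and finite sequences of integers $\lambda,\nu$, the $h$-plethysm coefficient is $b_{\lambda,\mu}^{\nu} = \langle h_\lambda[s_\mu], h_\nu\rangle$, where $s_\mu$ is the Schur function, $f[g]$ is plethysm and $\langle\cdot,\cdot\rangle$ is the Hall inner product. $t(\mu,N)$ denotes the set of semistandard Young tableaux of shape $\mu$ with entries in $\{1,\dots,N\}$. For $T\in t(\mu,N)$ and $1\le j\le N$, $\rho_j(T)$ is the number of entries equal to $j$ in $T$, and $\rho(T)=(\rho_1(T),\dots,\rho_N(T))$ is the weight of $T$. $\mathcal{P}_{\mu,N}=(\rho_j(T))_{T,j}$ is the matrix with rows indexed by $T\in t(\mu,N)$ and columns indexed by $j\in\{1,\dots,N\}$. -}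

module Defs where

open import Data.Nat using (ℕ; zero; suc; _+_; _*_; _≤_; _<_; _≥_; _≤ᵇ_; _<ᵇ_; _≡ᵇ_)
open import Data.Bool using (Bool; true; false; _∧_; if_then_else_)
open import Data.List as L using (List; []; _∷_; map; concatMap; filter; length; concat; zip; upTo; _++_)
open import Data.List.Relation.Unary.All using (All)
open import Data.List.Relation.Unary.Linked using (Linked)
open import Data.Vec as V using (Vec; lookup; tabulate)
open import Data.Fin using (Fin; toℕ)
open import Data.Product using (Σ; _×_)
open import Relation.Binary.PropositionalEquality using (_≡_)
open import Relation.Nullary.Decidable using (T?)
open import Data.Bool using (T)
open import Relation.Nullary.Decidable using (isYes)
open import Data.Vec.Properties using (≡-dec)
import Data.Nat

IsPartition : List ℕ → Set
IsPartition μ = Linked _≥_ μ × All (0 <_) μ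

pad : (N : ℕ) → List ℕ → Vec ℕ N
pad zero    _        = V.[]
pad (suc N) []       = 0 V.∷ pad N []
pad (suc N) (x ∷ xs) = x V.∷ pad N xs

-- A filling of shape μ is a list of rows
-- (row i has length μ_i); t(μ,N) is the list of all fillings with
-- entries in {1,…,N}, rows weakly increasing, columns strictly increasing.

words : ℕ → ℕ → List (List ℕ)
words zero    N = [] ∷ []
words (suc k) N = concatMap (λ a → map (a ∷_) (words k N)) (map suc (upTo N))

fillings : List ℕ → ℕ → List (List (List ℕ))
fillings []      N = [] ∷ []
fillings (m ∷ μ) N = concatMap (λ r → map (r ∷_) (fillings μ N)) (words m N)

rowWeak : List ℕ → Bool
rowWeak (a ∷ b ∷ r) = (a ≤ᵇ b) ∧ rowWeak (b ∷ r)
rowWeak _           = true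

pairsStrict : List ℕ → List ℕ → Bool
pairsStrict (a ∷ as) (b ∷ bs) = (a <ᵇ b) ∧ pairsStrict as bs
pairsStrict _        _        = true

colStrict : List (List ℕ) → Bool
colStrict (r₁ ∷ r₂ ∷ rs) = pairsStrict r₁ r₂ ∧ colStrict (r₂ ∷ rs)
colStrict _              = true

allB : {A : Set} → (A → Bool) → List A → Bool
allB p []       = true
allB p (x ∷ xs) = p x ∧ allB p xs

isSSYT : List (List ℕ) → Bool
isSSYT T = allB rowWeak T ∧ colStrict T

tabs : List ℕ → ℕ → List (List (List ℕ))
tabs μ N = filter (λ T → T? (isSSYT T)) (fillings μ N)

countL : ℕ → List ℕ → ℕ
countL a []       = 0
countL a (x ∷ xs) = (if a ≡ᵇ x then 1 else 0) + countL a xs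

-- weight ρ(T) = (ρ_1(T),…,ρ_N(T)); index j : Fin N stands for j+1
ρ : (N : ℕ) → List (List ℕ) → Vec ℕ N
ρ N T = tabulate (λ j → countL (suc (toℕ j)) (concat T))

-- Polynomials in n variables with non-negative integer coefficients,
-- represented as formal sums (lists) of monomials x^e, e ∈ ℕ^n.

Mono : ℕ → Set
Mono n = Vec ℕ n

Poly : ℕ → Set
Poly n = List (Mono n)

one : {n : ℕ} → Poly n
one = V.replicate _ 0 ∷ []

_*P_ : {n : ℕ} → Poly n → Poly n → Poly n
p *P q = concatMap (λ a → map (λ b → V.zipWith _+_ a b) q) p

schur : (n : ℕ) → List ℕ → Poly n
schur n μ = map (ρ n) (tabs μ n)

-- plethysm h_r[g] for g a sum of monomials y_1+…+y_m (with
-- multiplicity): h_r(y_1,…,y_m) = Σ_{i_1 ≤ … ≤ i_r} y_{i_1}⋯y_{i_r}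
hPleth : {n : ℕ} → ℕ → Poly n → Poly n
hPleth zero    g        = one
hPleth (suc r) []       = []
hPleth (suc r) (y ∷ ys) = (map (V.zipWith _+_ y) (hPleth r (y ∷ ys))) ++ hPleth (suc r) ys

hλPleth : {n : ℕ} → List ℕ → Poly n → Poly n
hλPleth []       g = one
hλPleth (r ∷ rs) g = hPleth r g *P hλPleth rs g

coeff : {n : ℕ} → Mono n → Poly n → ℕ
coeff e []       = 0
coeff e (x ∷ xs) = (if isYes (≡-dec Data.Nat._≟_ e x) then 1 else 0) + coeff e xs

-- h-plethysm coefficient b^ν_{λ,μ} = ⟨h_λ[s_μ], h_ν⟩.
-- By definition of the Hall inner product (⟨h_α, m_β⟩ = δ_{αβ}),
-- ⟨f, h_ν⟩ is the coefficient of m_{sort(ν)} in f, i.e. the coefficient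
-- of x^ν in f; since ν has ℓ(ν) entries, it may be computed in the
-- variables x_1,…,x_{ℓ(ν)} (setting the others to 0, which commutes
-- with plethysm by a Schur function).

bcoef : List ℕ → List ℕ → List ℕ → ℕ
bcoef lam μ ν = coeff (V.fromList ν) (hλPleth lam (schur (length ν) μ))

Pmat : (μ : List ℕ) (N : ℕ) → Vec (Vec ℕ N) (length (tabs μ N))
Pmat μ N = V.map (ρ N) (V.fromList (tabs μ N))

matMul : {a b c : ℕ} → Vec (Vec ℕ b) a → Vec (Vec ℕ c) b → Vec (Vec ℕ c) a
matMul {a} {b} {c} A B =
  tabulate (λ i → tabulate (λ j → V.sum (tabulate (λ t → lookup (lookup A i) t * lookup (lookup B t) j))))

rowSums : {a b : ℕ} → Vec (Vec ℕ b) a → Vec ℕ a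
rowSums A = V.map V.sum A

colSums : {a b : ℕ} → Vec (Vec ℕ b) a → Vec ℕ b
colSums {a} {b} A = tabulate (λ j → V.sum (tabulate (λ i → lookup (lookup A i) j)))

Q : (lam μ ν : List ℕ) (N : ℕ) → Set
Q lam μ ν N =
  Σ (Vec (Vec ℕ (length (tabs μ N))) N) λ M →
    (rowSums M ≡ pad N lam) × (colSums (matMul M (Pmat μ N)) ≡ pad N ν)

{-# OPTIONS --safe #-}
module Submission where

-- In N variables, s_μ is the list of the monomials x^ρ(T), T ∈ t(μ,N), and h_r of a
-- list of monomials y_1, …, y_K is the list of the products y_1^{c_1}⋯y_K^{c_K} over
-- the weak compositions c of r into K parts.  Hence h_λ[s_μ] is the list of the
-- monomials x^{colSums (M·P_{μ,N})} over the matrices M whose i-th row is a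
-- composition of λ_i, and the coefficient of x^ν counts Q(λ,μ,ν,N).  Since bcoef is
-- computed in ℓ(ν) variables only, one first passes to N variables: setting
-- x_{ℓ(ν)+1}, …, x_N to zero commutes with products and plethysm, and it turns s_μ in
-- N variables into s_μ in ℓ(ν) variables because a tableau has weight supported on
-- {1, …, ℓ(ν)} exactly when its entries are at most ℓ(ν).

open import Defs
open import Data.Nat using (ℕ; _≤_; _<_)
open import Data.List using (List; length)
open import Data.List.Relation.Unary.All using (All)
open import Data.Fin using (Fin)
open import Function.Bundles using (_↔_)

open import Axiom.UniquenessOfIdentityProofs using (UIP; module Decidable⇒UIP)
open import Data.Bool using (true; false; if_then_else_; T)
open import Data.Fin as Fin using (toℕ; _↑ˡ_; _↑ʳ_)
import Data.Fin.Properties as Fin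
open import Data.Empty using (⊥-elim)
open import Data.List as L using ([]; _∷_; map; filter; _++_; concat; concatMap; applyUpTo; upTo)
import Data.List.Properties as L
open import Data.List.Relation.Unary.All as All using ([]; _∷_; all?)
import Data.List.Relation.Unary.All.Properties as All
open import Data.Nat using (zero; suc; _+_; _*_; _≡ᵇ_; _≤?_; s≤s)
import Data.Nat.Properties as ℕ
open import Data.Product using (Σ; _×_; _,_; proj₁; proj₂)
open import Data.Product.Algebra using (×-cong; Σ-assoc)
open import Data.Product.Function.Dependent.Propositional using (Σ-↔)
open import Data.Product.Properties using (Σ-≡,≡→≡)
open import Data.Sum using (_⊎_; inj₁; inj₂; [_,_])
open import Data.Sum.Algebra using (⊎-cong; ⊎-assoc)
open import Data.Unit using (⊤; tt)
open import Data.Vec as V using (Vec; tabulate; lookup)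
import Data.Vec.Properties as V
open import Function using (_∘_; const; _⇔_; mk⇔; Equivalence; Inverse; mk↔ₛ′)
import Function.Properties.Equivalence as ⇔
open import Function.Properties.Inverse using (↔-refl; ↔-sym; ↔-trans)
open import Function.Related.Propositional using (module EquationalReasoning)
open import Level using (0ℓ)
open import Relation.Binary.PropositionalEquality hiding (J; [_])
open import Relation.Nullary using (Dec; yes; no; ¬_; contradiction)
open import Relation.Nullary.Decidable using (T?; isYes)
open import Relation.Unary using (Pred; Decidable; _≐_)

open Inverse using (to)

private
  variable
    A : Set
    I J : Set
    d K : ℕ

infixl 6 _+ᵥ_

_+ᵥ_ : Vec ℕ d → Vec ℕ d → Vec ℕ d
_+ᵥ_ = V.zipWith _+_

0ᵥ : Vec ℕ d
0ᵥ = V.replicate _ 0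

+ᵥ-identityˡ : (x : Vec ℕ d) → 0ᵥ +ᵥ x ≡ x
+ᵥ-identityˡ = V.zipWith-identityˡ ℕ.+-identityˡ

+ᵥ-assoc : (x y z : Vec ℕ d) → x +ᵥ y +ᵥ z ≡ x +ᵥ (y +ᵥ z)
+ᵥ-assoc = V.zipWith-assoc ℕ.+-assoc

+ᵥ-≡-0ᵥ : (x y : Vec ℕ d) → x +ᵥ y ≡ 0ᵥ ⇔ (x ≡ 0ᵥ × y ≡ 0ᵥ)
+ᵥ-≡-0ᵥ x y = mk⇔ (split x y) (λ { (refl , refl) → +ᵥ-identityˡ 0ᵥ })
  where
  split : (x y : Vec ℕ d) → x +ᵥ y ≡ 0ᵥ → x ≡ 0ᵥ × y ≡ 0ᵥ
  split V.[]          V.[]          _  = refl , refl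
  split (zero V.∷ x)  (zero V.∷ y)  eq with split x y (V.∷-injectiveʳ eq)
  ... | refl , refl = refl , refl
  split (zero V.∷ x)  (suc _ V.∷ y) ()
  split (suc _ V.∷ x) (_ V.∷ y)     ()

map-suc* : ∀ c (y : Vec ℕ d) → V.map (suc c *_) y ≡ y +ᵥ V.map (c *_) y
map-suc* c V.[]       = refl
map-suc* c (a V.∷ y) = cong (a + c * a V.∷_) (map-suc* c y)

≡ᵥ-irrelevant : UIP (Vec ℕ d)
≡ᵥ-irrelevant = Decidable⇒UIP.≡-irrelevant (V.≡-dec ℕ._≟_)

take-0ᵥ : ∀ n {k} → V.take n {k} 0ᵥ ≡ 0ᵥ
take-0ᵥ zero    = refl
take-0ᵥ (suc n) = cong (0 V.∷_) (take-0ᵥ n)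

drop-0ᵥ : ∀ n {k} → V.drop n {k} 0ᵥ ≡ 0ᵥ
drop-0ᵥ zero    = refl
drop-0ᵥ (suc n) = drop-0ᵥ n

take-++ : ∀ {n k} (xs : Vec A n) (ys : Vec A k) → V.take n (xs V.++ ys) ≡ xs
take-++ V.[]       ys = refl
take-++ (x V.∷ xs) ys = cong (x V.∷_) (take-++ xs ys)

drop-++ : ∀ {n k} (xs : Vec A n) (ys : Vec A k) → V.drop n (xs V.++ ys) ≡ ys
drop-++ V.[]       ys = refl
drop-++ (x V.∷ xs) ys = drop-++ xs ys

take-tabulate : ∀ n {k} (f : Fin (n + k) → A) → V.take n (tabulate f) ≡ tabulate (f ∘ (_↑ˡ k))
take-tabulate zero    f = refl
take-tabulate (suc n) f = cong (f Fin.zero V.∷_) (take-tabulate n (f ∘ Fin.suc))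

drop-tabulate : ∀ n {k} (f : Fin (n + k) → A) → V.drop n (tabulate f) ≡ tabulate (f ∘ (n ↑ʳ_))
drop-tabulate zero    f = refl
drop-tabulate (suc n) f = drop-tabulate n (f ∘ Fin.suc)

tabulate-≡-0ᵥ : (f : Fin d → ℕ) → tabulate f ≡ 0ᵥ ⇔ (∀ j → f j ≡ 0)
tabulate-≡-0ᵥ f = mk⇔
  (λ eq j → trans (sym (V.lookup∘tabulate f j)) (trans (cong (λ v → lookup v j) eq) (V.lookup-replicate j 0)))
  (λ f≡0 → trans (V.tabulate-cong (λ j → trans (f≡0 j) (sym (V.lookup-replicate j 0)))) (V.tabulate∘lookup 0ᵥ))

tabulate-+ : (f g : Fin d → ℕ) → tabulate (λ j → f j + g j) ≡ tabulate f +ᵥ tabulate g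
tabulate-+ {zero}  f g = refl
tabulate-+ {suc d} f g = cong (f Fin.zero + g Fin.zero V.∷_) (tabulate-+ (f ∘ Fin.suc) (g ∘ Fin.suc))

filter-map : {P : Pred A 0ℓ} (P? : Decidable P) (f : J → A) (xs : List J) →
             filter P? (map f xs) ≡ map f (filter (P? ∘ f) xs)
filter-map P? f []       = refl
filter-map P? f (x ∷ xs) with P? (f x)
... | yes _ = cong (f x ∷_) (filter-map P? f xs)
... | no  _ = filter-map P? f xs

filter-comm : {P Q : Pred A 0ℓ} (P? : Decidable P) (Q? : Decidable Q) (xs : List A) →
              filter P? (filter Q? xs) ≡ filter Q? (filter P? xs)
filter-comm P? Q? []       = refl
filter-comm P? Q? (x ∷ xs) with P? x | Q? x
... | yes px | yes qx =
  trans (L.filter-accept P? px) (trans (cong (x ∷_) (filter-comm P? Q? xs)) (sym (L.filter-accept Q? qx)))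
... | yes _  | no ¬qx = trans (filter-comm P? Q? xs) (sym (L.filter-reject Q? ¬qx))
... | no ¬px | yes _  = trans (L.filter-reject P? ¬px) (filter-comm P? Q? xs)
... | no  _  | no  _  = filter-comm P? Q? xs

filter-cong-local : {P Q : Pred A 0ℓ} (P? : Decidable P) (Q? : Decidable Q) {xs : List A} →
                    All (λ x → P x ⇔ Q x) xs → filter P? xs ≡ filter Q? xs
filter-cong-local P? Q? {[]}     []                = refl
filter-cong-local P? Q? {x ∷ xs} (px⇔qx ∷ pxs⇔qxs) with P? x | Q? x
... | yes _  | yes _  = cong (x ∷_) (filter-cong-local P? Q? pxs⇔qxs)
... | no  _  | no  _  = filter-cong-local P? Q? pxs⇔qxs
... | yes px | no ¬qx = contradiction (Equivalence.to px⇔qx px) ¬qx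
... | no ¬px | yes qx = contradiction (Equivalence.from px⇔qx qx) ¬px

filter-all?-concatMap-∷ : {Q : Pred A 0ℓ} (Q? : Decidable Q) (as : List A) (xss : List (List A)) →
  filter (all? Q?) (concatMap (λ a → map (a ∷_) xss) as) ≡
  concatMap (λ a → map (a ∷_) (filter (all? Q?) xss)) (filter Q? as)
filter-all?-concatMap-∷ Q? []       xss = refl
filter-all?-concatMap-∷ Q? (a ∷ as) xss with Q? a
... | yes qa = begin
  filter (all? Q?) (map (a ∷_) xss ++ rest)
    ≡⟨ L.filter-++ (all? Q?) (map (a ∷_) xss) rest ⟩
  filter (all? Q?) (map (a ∷_) xss) ++ filter (all? Q?) rest
    ≡⟨ cong₂ _++_ (trans (filter-map (all? Q?) (a ∷_) xss)
                         (cong (map (a ∷_)) (L.filter-≐ _ (all? Q?) (All.tail , (qa ∷_)) xss)))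
                  (filter-all?-concatMap-∷ Q? as xss) ⟩
  map (a ∷_) (filter (all? Q?) xss) ++ concatMap (λ a → map (a ∷_) (filter (all? Q?) xss)) (filter Q? as) ∎
  where
  open ≡-Reasoning
  rest = concatMap (λ a → map (a ∷_) xss) as
... | no ¬qa = begin
  filter (all? Q?) (map (a ∷_) xss ++ rest)
    ≡⟨ L.filter-++ (all? Q?) (map (a ∷_) xss) rest ⟩
  filter (all? Q?) (map (a ∷_) xss) ++ filter (all? Q?) rest
    ≡⟨ cong₂ _++_ (trans (filter-map (all? Q?) (a ∷_) xss)
                         (cong (map (a ∷_)) (L.filter-none _ (All.universal (λ _ → ¬qa ∘ All.head) xss))))
                  (filter-all?-concatMap-∷ Q? as xss) ⟩
  concatMap (λ a → map (a ∷_) (filter (all? Q?) xss)) (filter Q? as) ∎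
  where
  open ≡-Reasoning
  rest = concatMap (λ a → map (a ∷_) xss) as

applyUpTo-+ : (f : ℕ → A) (n k : ℕ) → applyUpTo f (n + k) ≡ applyUpTo f n ++ applyUpTo (f ∘ (n +_)) k
applyUpTo-+ f zero    k = refl
applyUpTo-+ f (suc n) k = cong (f 0 ∷_) (applyUpTo-+ (f ∘ suc) n k)

filter-≤-range : ∀ n k → filter (_≤? n) (map suc (upTo (n + k))) ≡ map suc (upTo n)
filter-≤-range n k = begin
  filter (_≤? n) (map suc (upTo (n + k)))
    ≡⟨ cong (filter (_≤? n)) (trans (L.map-upTo suc (n + k)) (applyUpTo-+ suc n k)) ⟩
  filter (_≤? n) (applyUpTo suc n ++ applyUpTo (suc ∘ (n +_)) k)
    ≡⟨ L.filter-++ (_≤? n) (applyUpTo suc n) _ ⟩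
  filter (_≤? n) (applyUpTo suc n) ++ filter (_≤? n) (applyUpTo (suc ∘ (n +_)) k)
    ≡⟨ cong₂ _++_ (L.filter-all (_≤? n) (All.applyUpTo⁺₁ suc n (λ i<n → i<n)))
                  (L.filter-none (_≤? n) (All.applyUpTo⁺₂ _ k (λ i → ℕ.<⇒≱ (s≤s (ℕ.m≤m+n n i))))) ⟩
  applyUpTo suc n ++ []
    ≡⟨ trans (L.++-identityʳ _) (sym (L.map-upTo suc n)) ⟩
  map suc (upTo n) ∎
  where open ≡-Reasoning

-- Tableaux with bounded entries

words-bounded : ∀ m N → All (All (_≤ N)) (words m N)
words-bounded zero    N = [] ∷ []
words-bounded (suc m) N = All.concat⁺ (All.map⁺ (All.map⁺ (All.applyUpTo⁺₁ (λ i → i) N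
  (λ i<N → All.map⁺ (All.map (i<N ∷_) (words-bounded m N))))))

fillings-bounded : ∀ μ N → All (All (All (_≤ N))) (fillings μ N)
fillings-bounded []      N = [] ∷ []
fillings-bounded (m ∷ μ) N = All.concat⁺ (All.map⁺
  (All.map (λ r≤N → All.map⁺ (All.map (r≤N ∷_) (fillings-bounded μ N))) (words-bounded m N)))

filter-words : ∀ m n k → filter (all? (_≤? n)) (words m (n + k)) ≡ words m n
filter-words zero    n k = refl
filter-words (suc m) n k = begin
  filter (all? (_≤? n)) (concatMap (λ a → map (a ∷_) (words m (n + k))) (map suc (upTo (n + k))))
    ≡⟨ filter-all?-concatMap-∷ (_≤? n) (map suc (upTo (n + k))) (words m (n + k)) ⟩
  concatMap (λ a → map (a ∷_) (filter (all? (_≤? n)) (words m (n + k))))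
            (filter (_≤? n) (map suc (upTo (n + k))))
    ≡⟨ cong₂ (λ ws as → concatMap (λ a → map (a ∷_) ws) as) (filter-words m n k) (filter-≤-range n k) ⟩
  words (suc m) n ∎
  where open ≡-Reasoning

filter-fillings : ∀ μ n k → filter (all? (all? (_≤? n))) (fillings μ (n + k)) ≡ fillings μ n
filter-fillings []      n k = refl
filter-fillings (m ∷ μ) n k = begin
  filter (all? (all? (_≤? n))) (concatMap (λ r → map (r ∷_) (fillings μ (n + k))) (words m (n + k)))
    ≡⟨ filter-all?-concatMap-∷ (all? (_≤? n)) (words m (n + k)) (fillings μ (n + k)) ⟩
  concatMap (λ r → map (r ∷_) (filter (all? (all? (_≤? n))) (fillings μ (n + k))))
            (filter (all? (_≤? n)) (words m (n + k)))
    ≡⟨ cong₂ (λ Ts rs → concatMap (λ r → map (r ∷_) Ts) rs) (filter-fillings μ n k) (filter-words m n k) ⟩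
  fillings (m ∷ μ) n ∎
  where open ≡-Reasoning

weight : (N : ℕ) → List ℕ → Vec ℕ N
weight N w = tabulate (λ j → countL (suc (toℕ j)) w)

take-weight : ∀ n k w → V.take n (weight (n + k) w) ≡ weight n w
take-weight n k w =
  trans (take-tabulate n _) (V.tabulate-cong (λ j → cong (λ i → countL (suc i) w) (Fin.toℕ-↑ˡ j k)))

drop-weight : ∀ n k w → V.drop n (weight (n + k) w) ≡ tabulate (λ (j : Fin k) → countL (suc (n + toℕ j)) w)
drop-weight n k w =
  trans (drop-tabulate n _) (V.tabulate-cong (λ j → cong (λ i → countL (suc i) w) (Fin.toℕ-↑ʳ n j)))

countL-∷-≡0 : ∀ a x w → countL a (x ∷ w) ≡ 0 ⇔ (a ≢ x × countL a w ≡ 0)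
countL-∷-≡0 a x w with a ≡ᵇ x in a≡ᵇx
... | true  = mk⇔ (λ ()) (λ (a≢x , _) → contradiction (ℕ.≡ᵇ⇒≡ a x (subst T (sym a≡ᵇx) _)) a≢x)
... | false = mk⇔ (λ c≡0 → (λ a≡x → subst T a≡ᵇx (ℕ.≡⇒≡ᵇ a x a≡x)) , c≡0) proj₂

beyond-≢⇔≤ : ∀ {n k x} → x ≤ n + k → (∀ (j : Fin k) → suc (n + toℕ j) ≢ x) ⇔ x ≤ n
beyond-≢⇔≤ {n} {k} {x} x≤n+k =
  mk⇔ bounded (λ x≤n j → ℕ.<⇒≢ (s≤s (ℕ.≤-trans x≤n (ℕ.m≤m+n n _))) ∘ sym)
  where
  bounded : (∀ (j : Fin k) → suc (n + toℕ j) ≢ x) → x ≤ n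
  bounded beyond≢x with x ℕ.≤? n
  ... | yes x≤n = x≤n
  ... | no  x≰n with ℕ.m≤n⇒∃[o]m+o≡n (ℕ.≰⇒> x≰n)
  ...   | o , refl = contradiction (cong suc (cong (n +_) (Fin.toℕ-fromℕ< o<k))) (beyond≢x (Fin.fromℕ< o<k))
    where
    o<k : o < k
    o<k = ℕ.+-cancelˡ-≤ n _ _ (subst (_≤ n + k) (sym (ℕ.+-suc n o)) x≤n+k)

counts-beyond-≡0⇔bounded : ∀ n k w → All (_≤ n + k) w →
  (∀ (j : Fin k) → countL (suc (n + toℕ j)) w ≡ 0) ⇔ All (_≤ n) w
counts-beyond-≡0⇔bounded n k []      []              = mk⇔ (λ _ → []) (λ _ _ → refl)
counts-beyond-≡0⇔bounded n k (x ∷ w) (x≤n+k ∷ w≤n+k) = mk⇔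
  (λ counts≡0 → Equivalence.to (beyond-≢⇔≤ x≤n+k) (λ j → proj₁ (split j counts≡0))
              ∷ Equivalence.to ih (λ j → proj₂ (split j counts≡0)))
  (λ { (x≤n ∷ w≤n) j → Equivalence.from (countL-∷-≡0 _ x w)
         (Equivalence.from (beyond-≢⇔≤ x≤n+k) x≤n j , Equivalence.from ih w≤n j) })
  where
  ih = counts-beyond-≡0⇔bounded n k w w≤n+k
  split : ∀ j → (∀ (j : Fin k) → countL (suc (n + toℕ j)) (x ∷ w) ≡ 0) →
          suc (n + toℕ j) ≢ x × countL (suc (n + toℕ j)) w ≡ 0
  split j counts≡0 = Equivalence.to (countL-∷-≡0 _ x w) (counts≡0 j)

δ : Vec ℕ d → Vec ℕ d → ℕ
δ a b = if isYes (V.≡-dec ℕ._≟_ a b) then 1 else 0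

δ-cong : ∀ {d′} {a b : Vec ℕ d} {c e : Vec ℕ d′} → (a ≡ b ⇔ c ≡ e) → δ a b ≡ δ c e
δ-cong {a = a} {b} {c} {e} a≡b⇔c≡e with V.≡-dec ℕ._≟_ a b | V.≡-dec ℕ._≟_ c e
... | yes _   | yes _   = refl
... | no  _   | no  _   = refl
... | yes a≡b | no  c≢e = contradiction (Equivalence.to a≡b⇔c≡e a≡b) c≢e
... | no  a≢b | yes c≡e = contradiction (Equivalence.from a≡b⇔c≡e c≡e) a≢b

δ-≢ : {a b : Vec ℕ d} → a ≢ b → δ a b ≡ 0
δ-≢ {a = a} {b} a≢b with V.≡-dec ℕ._≟_ a b
... | yes a≡b = contradiction a≡b a≢b
... | no  _   = refl

δ↔≡ : (e x : Mono d) → Fin (δ e x) ↔ (x ≡ e)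
δ↔≡ e x with V.≡-dec ℕ._≟_ e x
... | yes refl =
  mk↔ₛ′ (λ _ → refl) (λ _ → Fin.zero) (λ _ → ≡ᵥ-irrelevant _ _) (λ { Fin.zero → refl ; (Fin.suc ()) })
... | no  e≢x  =
  mk↔ₛ′ (λ ()) (λ x≡e → ⊥-elim (e≢x (sym x≡e))) (λ x≡e → ⊥-elim (e≢x (sym x≡e))) (λ ())

-- Setting the variables x_{n+1}, …, x_{n+k} to zero

module Restriction (n k : ℕ) where

  Vanishing : Mono (n + k) → Set
  Vanishing e = V.drop n e ≡ 0ᵥ

  vanishing? : Decidable Vanishing
  vanishing? e = V.≡-dec ℕ._≟_ (V.drop n e) 0ᵥ

  restrict : Poly (n + k) → Poly n
  restrict p = map (V.take n) (filter vanishing? p)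

  extend : Mono n → Mono (n + k)
  extend e = e V.++ 0ᵥ

  extend≡⇔≡take : ∀ {e x} → Vanishing x → extend e ≡ x ⇔ e ≡ V.take n x
  extend≡⇔≡take {e} {x} x-vanishes = mk⇔
    (λ { refl → sym (take-++ e 0ᵥ) })
    (λ { refl → trans (cong (V.take n x V.++_) (sym x-vanishes)) (V.take++drop≡id n x) })

  coeff-restrict : ∀ e p → coeff (extend e) p ≡ coeff e (restrict p)
  coeff-restrict e []      = refl
  coeff-restrict e (x ∷ p) with vanishing? x
  ... | yes x-vanishes = cong₂ _+_ (δ-cong (extend≡⇔≡take x-vanishes)) (coeff-restrict e p)
  ... | no  x-survives = cong₂ _+_ (δ-≢ λ { refl → x-survives (drop-++ e 0ᵥ) }) (coeff-restrict e p)

  restrict-accept : ∀ {y} ys → Vanishing y → restrict (y ∷ ys) ≡ V.take n y ∷ restrict ys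
  restrict-accept ys y-vanishes = cong (map (V.take n)) (L.filter-accept vanishing? y-vanishes)

  restrict-reject : ∀ {y} ys → ¬ Vanishing y → restrict (y ∷ ys) ≡ restrict ys
  restrict-reject ys y-survives = cong (map (V.take n)) (L.filter-reject vanishing? y-survives)

  restrict-++ : ∀ p q → restrict (p ++ q) ≡ restrict p ++ restrict q
  restrict-++ p q = trans (cong (map (V.take n)) (L.filter-++ vanishing? p q))
                          (L.map-++ (V.take n) (filter vanishing? p) (filter vanishing? q))

  restrict-one : restrict one ≡ one
  restrict-one = trans (restrict-accept [] (drop-0ᵥ n)) (cong (_∷ []) (take-0ᵥ n))

  vanishing-+ᵥ : ∀ x y → Vanishing (x +ᵥ y) ⇔ (Vanishing x × Vanishing y)
  vanishing-+ᵥ x y = subst (λ z → z ≡ 0ᵥ ⇔ (Vanishing x × Vanishing y)) (sym (V.drop-zipWith _+_ x y))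
    (+ᵥ-≡-0ᵥ (V.drop n x) (V.drop n y))

  restrict-translate : ∀ {y} p → Vanishing y → restrict (map (y +ᵥ_) p) ≡ map (V.take n y +ᵥ_) (restrict p)
  restrict-translate {y} p y-vanishes = begin
    map (V.take n) (filter vanishing? (map (y +ᵥ_) p))
      ≡⟨ cong (map (V.take n)) (filter-map vanishing? (y +ᵥ_) p) ⟩
    map (V.take n) (map (y +ᵥ_) (filter (vanishing? ∘ (y +ᵥ_)) p))
      ≡⟨ cong (map (V.take n) ∘ map (y +ᵥ_)) (L.filter-≐ _ vanishing? shifted≐ p) ⟩
    map (V.take n) (map (y +ᵥ_) (filter vanishing? p))
      ≡⟨ sym (L.map-∘ _) ⟩
    map (V.take n ∘ (y +ᵥ_)) (filter vanishing? p)
      ≡⟨ L.map-cong (V.take-zipWith _+_ y) _ ⟩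
    map ((V.take n y +ᵥ_) ∘ V.take n) (filter vanishing? p)
      ≡⟨ L.map-∘ _ ⟩
    map (V.take n y +ᵥ_) (restrict p) ∎
    where
    open ≡-Reasoning
    shifted≐ : (Vanishing ∘ (y +ᵥ_)) ≐ Vanishing
    shifted≐ = (λ {x} → proj₂ ∘ Equivalence.to (vanishing-+ᵥ y x))
             , (λ {x} x-vanishes → Equivalence.from (vanishing-+ᵥ y x) (y-vanishes , x-vanishes))

  restrict-translate-null : ∀ {y} p → ¬ Vanishing y → restrict (map (y +ᵥ_) p) ≡ []
  restrict-translate-null {y} p y-survives = cong (map (V.take n)) (begin
    filter vanishing? (map (y +ᵥ_) p)
      ≡⟨ filter-map vanishing? (y +ᵥ_) p ⟩
    map (y +ᵥ_) (filter (vanishing? ∘ (y +ᵥ_)) p)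
      ≡⟨ cong (map (y +ᵥ_)) (L.filter-none _ (All.universal survives p)) ⟩
    [] ∎)
    where
    open ≡-Reasoning
    survives : ∀ x → ¬ Vanishing (y +ᵥ x)
    survives x = y-survives ∘ proj₁ ∘ Equivalence.to (vanishing-+ᵥ y x)

  restrict-hPleth-step : ∀ {r y ys} → Dec (Vanishing y) →
    restrict (hPleth r (y ∷ ys)) ≡ hPleth r (restrict (y ∷ ys)) →
    restrict (hPleth (suc r) ys) ≡ hPleth (suc r) (restrict ys) →
    restrict (hPleth (suc r) (y ∷ ys)) ≡ hPleth (suc r) (restrict (y ∷ ys))
  restrict-hPleth-step {r} {y} {ys} (yes y-vanishes) ih₁ ih₂ = begin
    restrict (map (y +ᵥ_) (hPleth r (y ∷ ys)) ++ hPleth (suc r) ys)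
      ≡⟨ restrict-++ (map (y +ᵥ_) (hPleth r (y ∷ ys))) (hPleth (suc r) ys) ⟩
    restrict (map (y +ᵥ_) (hPleth r (y ∷ ys))) ++ restrict (hPleth (suc r) ys)
      ≡⟨ cong₂ _++_ (restrict-translate (hPleth r (y ∷ ys)) y-vanishes) ih₂ ⟩
    map (V.take n y +ᵥ_) (restrict (hPleth r (y ∷ ys))) ++ hPleth (suc r) (restrict ys)
      ≡⟨ cong (λ h → map (V.take n y +ᵥ_) h ++ hPleth (suc r) (restrict ys))
              (trans ih₁ (cong (hPleth r) (restrict-accept ys y-vanishes))) ⟩
    hPleth (suc r) (V.take n y ∷ restrict ys)
      ≡⟨ cong (hPleth (suc r)) (sym (restrict-accept ys y-vanishes)) ⟩
    hPleth (suc r) (restrict (y ∷ ys)) ∎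
    where open ≡-Reasoning
  restrict-hPleth-step {r} {y} {ys} (no y-survives) ih₁ ih₂ = begin
    restrict (map (y +ᵥ_) (hPleth r (y ∷ ys)) ++ hPleth (suc r) ys)
      ≡⟨ restrict-++ (map (y +ᵥ_) (hPleth r (y ∷ ys))) (hPleth (suc r) ys) ⟩
    restrict (map (y +ᵥ_) (hPleth r (y ∷ ys))) ++ restrict (hPleth (suc r) ys)
      ≡⟨ cong₂ _++_ (restrict-translate-null (hPleth r (y ∷ ys)) y-survives) ih₂ ⟩
    hPleth (suc r) (restrict ys)
      ≡⟨ cong (hPleth (suc r)) (sym (restrict-reject ys y-survives)) ⟩
    hPleth (suc r) (restrict (y ∷ ys)) ∎
    where open ≡-Reasoning

  restrict-hPleth : ∀ r g → restrict (hPleth r g) ≡ hPleth r (restrict g)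
  restrict-hPleth zero    g        = restrict-one
  restrict-hPleth (suc r) []       = refl
  restrict-hPleth (suc r) (y ∷ ys) =
    restrict-hPleth-step (vanishing? y) (restrict-hPleth r (y ∷ ys)) (restrict-hPleth (suc r) ys)

  restrict-*P : ∀ p q → restrict (p *P q) ≡ restrict p *P restrict q
  restrict-*P []      q = refl
  restrict-*P (x ∷ p) q with vanishing? x
  ... | yes x-vanishes = begin
    restrict (map (x +ᵥ_) q ++ p *P q)
      ≡⟨ restrict-++ (map (x +ᵥ_) q) (p *P q) ⟩
    restrict (map (x +ᵥ_) q) ++ restrict (p *P q)
      ≡⟨ cong₂ _++_ (restrict-translate q x-vanishes) (restrict-*P p q) ⟩
    map (V.take n x +ᵥ_) (restrict q) ++ restrict p *P restrict q ∎
    where open ≡-Reasoning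
  ... | no x-survives = begin
    restrict (map (x +ᵥ_) q ++ p *P q)
      ≡⟨ restrict-++ (map (x +ᵥ_) q) (p *P q) ⟩
    restrict (map (x +ᵥ_) q) ++ restrict (p *P q)
      ≡⟨ cong₂ _++_ (restrict-translate-null q x-survives) (restrict-*P p q) ⟩
    restrict p *P restrict q ∎
    where open ≡-Reasoning

  restrict-hλPleth : ∀ lam g → restrict (hλPleth lam g) ≡ hλPleth lam (restrict g)
  restrict-hλPleth []       g = restrict-one
  restrict-hλPleth (r ∷ rs) g = begin
    restrict (hPleth r g *P hλPleth rs g)            ≡⟨ restrict-*P (hPleth r g) (hλPleth rs g) ⟩
    restrict (hPleth r g) *P restrict (hλPleth rs g) ≡⟨ cong₂ _*P_ (restrict-hPleth r g) (restrict-hλPleth rs g) ⟩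
    hPleth r (restrict g) *P hλPleth rs (restrict g) ∎
    where open ≡-Reasoning

  vanishing-weight⇔bounded : ∀ w → All (_≤ n + k) w → Vanishing (weight (n + k) w) ⇔ All (_≤ n) w
  vanishing-weight⇔bounded w w≤n+k = subst (λ v → (v ≡ 0ᵥ) ⇔ All (_≤ n) w) (sym (drop-weight n k w))
    (⇔.trans (tabulate-≡-0ᵥ _) (counts-beyond-≡0⇔bounded n k w w≤n+k))

  vanishing-ρ⇔bounded : ∀ T → All (All (_≤ n + k)) T → Vanishing (ρ (n + k) T) ⇔ All (All (_≤ n)) T
  vanishing-ρ⇔bounded T T≤n+k = ⇔.trans
    (vanishing-weight⇔bounded (concat T) (All.concat⁺ T≤n+k)) (mk⇔ All.concat⁻ All.concat⁺)

  restrict-schur : ∀ μ → restrict (schur (n + k) μ) ≡ schur n μ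
  restrict-schur μ = begin
    map (V.take n) (filter vanishing? (map (ρ (n + k)) (filter ssyt? F)))
      ≡⟨ cong (map (V.take n)) (filter-map vanishing? (ρ (n + k)) (filter ssyt? F)) ⟩
    map (V.take n) (map (ρ (n + k)) (filter (vanishing? ∘ ρ (n + k)) (filter ssyt? F)))
      ≡⟨ sym (L.map-∘ _) ⟩
    map (V.take n ∘ ρ (n + k)) (filter (vanishing? ∘ ρ (n + k)) (filter ssyt? F))
      ≡⟨ L.map-cong (take-weight n k ∘ concat) _ ⟩
    map (ρ n) (filter (vanishing? ∘ ρ (n + k)) (filter ssyt? F))
      ≡⟨ cong (map (ρ n)) (filter-comm (vanishing? ∘ ρ (n + k)) ssyt? F) ⟩
    map (ρ n) (filter ssyt? (filter (vanishing? ∘ ρ (n + k)) F))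
      ≡⟨ cong (map (ρ n) ∘ filter ssyt?)
              (filter-cong-local _ _ (All.map (λ {T} → vanishing-ρ⇔bounded T) (fillings-bounded μ (n + k)))) ⟩
    map (ρ n) (filter ssyt? (filter (all? (all? (_≤? n))) F))
      ≡⟨ cong (map (ρ n) ∘ filter ssyt?) (filter-fillings μ n k) ⟩
    map (ρ n) (filter ssyt? (fillings μ n)) ∎
    where
    open ≡-Reasoning
    F = fillings μ (n + k)
    ssyt? = λ T → T? (isSSYT T)

pad-[] : ∀ N → pad N [] ≡ 0ᵥ
pad-[] zero    = refl
pad-[] (suc N) = cong (0 V.∷_) (pad-[] N)

pad≡extend : ∀ (ν : List ℕ) k → pad (length ν + k) ν ≡ V.fromList ν V.++ 0ᵥ
pad≡extend []      k = pad-[] k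
pad≡extend (x ∷ ν) k = cong (x V.∷_) (pad≡extend ν k)

toList-Pmat : ∀ μ N → V.toList (Pmat μ N) ≡ schur N μ
toList-Pmat μ N = trans (V.toList-map (ρ N) (V.fromList (tabs μ N))) (cong (map (ρ N)) (V.toList∘fromList (tabs μ N)))

bcoef≡coeff-pad : ∀ lam μ ν k → let N = length ν + k in
  bcoef lam μ ν ≡ coeff (pad N ν) (hλPleth lam (V.toList (Pmat μ N)))
bcoef≡coeff-pad lam μ ν k = begin
  coeff (V.fromList ν) (hλPleth lam (schur n μ))
    ≡⟨ cong (coeff (V.fromList ν) ∘ hλPleth lam) (sym (restrict-schur μ)) ⟩
  coeff (V.fromList ν) (hλPleth lam (restrict (schur (n + k) μ)))
    ≡⟨ cong (coeff (V.fromList ν)) (sym (restrict-hλPleth lam (schur (n + k) μ))) ⟩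
  coeff (V.fromList ν) (restrict (hλPleth lam (schur (n + k) μ)))
    ≡⟨ sym (coeff-restrict (V.fromList ν) (hλPleth lam (schur (n + k) μ))) ⟩
  coeff (extend (V.fromList ν)) (hλPleth lam (schur (n + k) μ))
    ≡⟨ cong₂ coeff (sym (pad≡extend ν k)) (cong (hλPleth lam) (sym (toList-Pmat μ (n + k)))) ⟩
  coeff (pad (n + k) ν) (hλPleth lam (V.toList (Pmat μ (n + k)))) ∎
  where
  open ≡-Reasoning
  n = length ν
  open Restriction n k

-- Polynomials as families of monomials

record Lists (p : Poly d) {I : Set} (v : I → Mono d) : Set where
  field
    position        : I ↔ Fin (length p)
    lookup-position : ∀ i → L.lookup p (to position i) ≡ v i
open Lists

lists-lookup : (p : Poly d) → Lists p (L.lookup p)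
lists-lookup p = record { position = ↔-refl ; lookup-position = λ _ → refl }

lists-reindex : {p : Poly d} {v : I → Mono d} (φ : J ↔ I) → Lists p v → Lists p (v ∘ to φ)
lists-reindex φ l = record
  { position = ↔-trans φ (position l) ; lookup-position = lookup-position l ∘ to φ }

lists-cong : {p : Poly d} {v w : I → Mono d} → (∀ i → v i ≡ w i) → Lists p v → Lists p w
lists-cong v≗w l = record
  { position = position l ; lookup-position = λ i → trans (lookup-position l i) (v≗w i) }

lists-empty : {v : I → Mono d} → ¬ I → Lists [] v
lists-empty ¬i = record
  { position = mk↔ₛ′ (⊥-elim ∘ ¬i) (λ ()) (λ ()) (⊥-elim ∘ ¬i) ; lookup-position = ⊥-elim ∘ ¬i }

lists-singleton : (x : Mono d) → Lists (x ∷ []) (const {B = ⊤} x)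
lists-singleton x = lists-cong (λ _ → refl) (lists-reindex (↔-sym Fin.1↔⊤) (lists-lookup (x ∷ [])))

suc↔⊤⊎ : ∀ {n} → Fin (suc n) ↔ (⊤ ⊎ Fin n)
suc↔⊤⊎ = ↔-trans Fin.+↔⊎ (⊎-cong Fin.1↔⊤ ↔-refl)

Σ-Fin-suc↔ : ∀ {n} (P : Fin (suc n) → Set) → Σ (Fin (suc n)) P ↔ (P Fin.zero ⊎ Σ (Fin n) (P ∘ Fin.suc))
Σ-Fin-suc↔ P = mk↔ₛ′
  (λ { (Fin.zero , p) → inj₁ p ; (Fin.suc i , p) → inj₂ (i , p) })
  [ (Fin.zero ,_) , (λ (i , p) → Fin.suc i , p) ]
  (λ { (inj₁ _) → refl ; (inj₂ _) → refl })
  (λ { (Fin.zero , _) → refl ; (Fin.suc _ , _) → refl })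

lists-∷ : ∀ {x : Mono d} {p} {v : I → Mono d} → Lists p v → Lists (x ∷ p) [ const x , v ]
lists-∷ l = record
  { position        = ↔-trans (⊎-cong ↔-refl (position l)) (↔-sym suc↔⊤⊎)
  ; lookup-position = λ { (inj₁ tt) → refl ; (inj₂ i) → lookup-position l i } }

lists-++-lookup : (p q : Poly d) → Lists (p ++ q) [ L.lookup p , L.lookup q ]
lists-++-lookup []      q = lists-cong (λ { (inj₁ ()) ; (inj₂ j) → refl })
  (lists-reindex (mk↔ₛ′ [ (λ ()) , (λ j → j) ] inj₂ (λ _ → refl) (λ { (inj₁ ()) ; (inj₂ _) → refl }))
                 (lists-lookup q))
lists-++-lookup (x ∷ p) q =
  lists-cong (λ { (inj₁ Fin.zero) → refl ; (inj₁ (Fin.suc i)) → refl ; (inj₂ j) → refl })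
  (lists-reindex (↔-trans (⊎-cong suc↔⊤⊎ ↔-refl) (⊎-assoc 0ℓ _ _ _)) (lists-∷ (lists-++-lookup p q)))

lists-++ : ∀ {p q : Poly d} {v : I → Mono d} {w : J → Mono d} → Lists p v → Lists q w → Lists (p ++ q) [ v , w ]
lists-++ {p = p} {q} lp lq = lists-cong (λ { (inj₁ i) → lookup-position lp i ; (inj₂ j) → lookup-position lq j })
  (lists-reindex (⊎-cong (position lp) (position lq)) (lists-++-lookup p q))

lists-map-lookup : ∀ {d′} (f : Mono d → Mono d′) (p : Poly d) → Lists (map f p) (f ∘ L.lookup p)
lists-map-lookup f []      = lists-empty (λ ())
lists-map-lookup f (x ∷ p) = lists-cong (λ { Fin.zero → refl ; (Fin.suc i) → refl })
  (lists-reindex suc↔⊤⊎ (lists-∷ (lists-map-lookup f p)))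

lists-map : ∀ {d′} (f : Mono d → Mono d′) {p : Poly d} {v : I → Mono d} → Lists p v → Lists (map f p) (f ∘ v)
lists-map f {p} l = lists-cong (cong f ∘ lookup-position l) (lists-reindex (position l) (lists-map-lookup f p))

lists-*P-lookup : (p q : Poly d) → Lists (p *P q) (λ (i , j) → L.lookup p i +ᵥ L.lookup q j)
lists-*P-lookup []      q = lists-empty (λ { (() , _) })
lists-*P-lookup (x ∷ p) q = lists-cong (λ { (Fin.zero , j) → refl ; (Fin.suc i , j) → refl })
  (lists-reindex (Σ-Fin-suc↔ (const (Fin (length q))))
    (lists-++ (lists-map-lookup (x +ᵥ_) q) (lists-*P-lookup p q)))

lists-*P : ∀ {p q : Poly d} {v : I → Mono d} {w : J → Mono d} → Lists p v → Lists q w →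
           Lists (p *P q) (λ (i , j) → v i +ᵥ w j)
lists-*P {p = p} {q} lp lq =
  lists-cong (λ (i , j) → cong₂ _+ᵥ_ (lookup-position lp i) (lookup-position lq j))
  (lists-reindex (×-cong (position lp) (position lq)) (lists-*P-lookup p q))

coeff-lookup : (e : Mono d) (p : Poly d) → Fin (coeff e p) ↔ Σ (Fin (length p)) (λ k → L.lookup p k ≡ e)
coeff-lookup e []      = mk↔ₛ′ (λ ()) (λ { (() , _) }) (λ { (() , _) }) (λ ())
coeff-lookup e (x ∷ p) =
  ↔-trans Fin.+↔⊎ (↔-trans (⊎-cong (δ↔≡ e x) (coeff-lookup e p)) (↔-sym (Σ-Fin-suc↔ _)))

coeff-lists : ∀ {p : Poly d} {v : I → Mono d} → Lists p v →
              (e : Mono d) → Fin (coeff e p) ↔ Σ I (λ i → v i ≡ e)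
coeff-lists {p = p} {v} l e = ↔-trans (coeff-lookup e p) (↔-sym (Σ-↔ (position l)
  (λ {i} → subst (λ x → (v i ≡ e) ↔ (x ≡ e)) (sym (lookup-position l i)) ↔-refl)))

-- Plethysms as families indexed by compositions and matrices

Composition : ℕ → ℕ → Set
Composition r m = Σ (Vec ℕ m) (λ c → V.sum c ≡ r)

lincomb : ∀ {m} → Vec ℕ m → Vec (Mono d) m → Mono d
lincomb V.[]       V.[]       = 0ᵥ
lincomb (c V.∷ cs) (y V.∷ G) = V.map (c *_) y +ᵥ lincomb cs G

lincomb-0ᵥ : ∀ {m} (G : Vec (Mono d) m) → lincomb 0ᵥ G ≡ 0ᵥ
lincomb-0ᵥ V.[]       = refl
lincomb-0ᵥ (y V.∷ G) = trans (cong₂ _+ᵥ_ (V.map-const y 0) (lincomb-0ᵥ G)) (+ᵥ-identityˡ 0ᵥ)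

sum≡0⇒≡0ᵥ : ∀ {m} (c : Vec ℕ m) → V.sum c ≡ 0 → c ≡ 0ᵥ
sum≡0⇒≡0ᵥ V.[]         _   = refl
sum≡0⇒≡0ᵥ (zero V.∷ c) Σ≡0 = cong (0 V.∷_) (sum≡0⇒≡0ᵥ c Σ≡0)

composition-zero↔⊤ : ∀ {m} → Composition 0 m ↔ ⊤
composition-zero↔⊤ {m} = mk↔ₛ′ (const tt) (λ _ → 0ᵥ , sum-0ᵥ m) (λ _ → refl)
  (λ (c , Σ≡0) → Σ-≡,≡→≡ (sym (sum≡0⇒≡0ᵥ c Σ≡0) , ℕ.≡-irrelevant _ _))
  where
  sum-0ᵥ : ∀ m → V.sum (0ᵥ {m}) ≡ 0
  sum-0ᵥ zero    = refl
  sum-0ᵥ (suc m) = sum-0ᵥ m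

composition-suc↔ : ∀ {r m} →
  Composition (suc r) (suc m) ↔ (Composition r (suc m) ⊎ Composition (suc r) m)
composition-suc↔ {r} {m} = mk↔ₛ′ split unsplit split∘unsplit unsplit∘split
  where
  split : Composition (suc r) (suc m) → Composition r (suc m) ⊎ Composition (suc r) m
  split ((zero   V.∷ c) , Σ≡) = inj₂ (c , Σ≡)
  split ((suc c₀ V.∷ c) , Σ≡) = inj₁ ((c₀ V.∷ c) , ℕ.suc-injective Σ≡)

  unsplit : Composition r (suc m) ⊎ Composition (suc r) m → Composition (suc r) (suc m)
  unsplit (inj₁ ((c₀ V.∷ c) , Σ≡)) = (suc c₀ V.∷ c) , cong suc Σ≡
  unsplit (inj₂ (c , Σ≡))          = (0 V.∷ c) , Σ≡

  split∘unsplit : ∀ c → split (unsplit c) ≡ c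
  split∘unsplit (inj₁ ((c₀ V.∷ c) , Σ≡)) = cong inj₁ (Σ-≡,≡→≡ (refl , ℕ.≡-irrelevant _ _))
  split∘unsplit (inj₂ _)                 = refl

  unsplit∘split : ∀ c → unsplit (split c) ≡ c
  unsplit∘split ((zero   V.∷ c) , Σ≡) = refl
  unsplit∘split ((suc c₀ V.∷ c) , Σ≡) = Σ-≡,≡→≡ (refl , ℕ.≡-irrelevant _ _)

lists-hPleth : ∀ r {m} (G : Vec (Mono d) m) →
               Lists (hPleth r (V.toList G)) {Composition r m} (λ c → lincomb (proj₁ c) G)
lists-hPleth zero    G =
  lists-cong (λ (c , Σ≡0) → sym (trans (cong (λ c → lincomb c G) (sum≡0⇒≡0ᵥ c Σ≡0)) (lincomb-0ᵥ G)))
  (lists-reindex composition-zero↔⊤ (lists-singleton 0ᵥ))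
lists-hPleth (suc r) V.[]      = lists-empty (λ { (V.[] , ()) })
lists-hPleth (suc r) (y V.∷ G) = lists-cong value
  (lists-reindex composition-suc↔ (lists-++ (lists-map (y +ᵥ_) (lists-hPleth r (y V.∷ G))) (lists-hPleth (suc r) G)))
  where
  value : ∀ c → _ ≡ lincomb (proj₁ c) (y V.∷ G)
  value ((zero V.∷ c) , _)   = sym (trans (cong (_+ᵥ lincomb c G) (V.map-const y 0)) (+ᵥ-identityˡ (lincomb c G)))
  value ((suc c₀ V.∷ c) , _) = trans (sym (+ᵥ-assoc y (V.map (c₀ *_) y) (lincomb c G)))
                                     (cong (_+ᵥ lincomb c G) (sym (map-suc* c₀ y)))

WithRowSums : (K : ℕ) {a : ℕ} → Vec ℕ a → Set
WithRowSums K {a} xs = Σ (Vec (Vec ℕ K) a) (λ M → rowSums M ≡ xs)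

rowSums-∷↔ : ∀ {a x} {xs : Vec ℕ a} → WithRowSums K (x V.∷ xs) ↔ (Composition x K × WithRowSums K xs)
rowSums-∷↔ = mk↔ₛ′
  (λ { ((c V.∷ M) , eq) → (c , V.∷-injectiveˡ eq) , (M , V.∷-injectiveʳ eq) })
  (λ ((c , Σ≡) , (M , eq)) → (c V.∷ M) , cong₂ V._∷_ Σ≡ eq)
  (λ ((c , Σ≡) , (M , eq)) →
     cong₂ _,_ (Σ-≡,≡→≡ (refl , ℕ.≡-irrelevant _ _)) (Σ-≡,≡→≡ (refl , ≡ᵥ-irrelevant _ _)))
  (λ { ((c V.∷ M) , eq) → Σ-≡,≡→≡ (refl , ≡ᵥ-irrelevant _ _) })

zero-rows↔⊤ : ∀ N → WithRowSums K (pad N []) ↔ ⊤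
zero-rows↔⊤ zero    = mk↔ₛ′ (const tt) (λ _ → V.[] , refl) (λ _ → refl) (λ { (V.[] , refl) → refl })
zero-rows↔⊤ (suc N) = ↔-trans rowSums-∷↔ (↔-trans (×-cong composition-zero↔⊤ (zero-rows↔⊤ N))
  (mk↔ₛ′ (const tt) (const (tt , tt)) (λ _ → refl) (λ _ → refl)))

lincomb-tabulate : ∀ {m} (c : Vec ℕ m) (P : Vec (Mono d) m) →
  tabulate (λ j → V.sum (tabulate (λ t → lookup c t * lookup (lookup P t) j))) ≡ lincomb c P
lincomb-tabulate V.[]        V.[]      = Equivalence.from (tabulate-≡-0ᵥ _) (λ _ → refl)
lincomb-tabulate (c₀ V.∷ c) (y V.∷ P) = begin
  tabulate (λ j → c₀ * lookup y j + V.sum (tabulate (λ t → lookup c t * lookup (lookup P t) j)))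
    ≡⟨ tabulate-+ _ _ ⟩
  tabulate (λ j → c₀ * lookup y j) +ᵥ tabulate (λ j → V.sum (tabulate (λ t → lookup c t * lookup (lookup P t) j)))
    ≡⟨ cong₂ _+ᵥ_ (trans (V.tabulate-∘ (c₀ *_) (lookup y)) (cong (V.map (c₀ *_)) (V.tabulate∘lookup y)))
                  (lincomb-tabulate c P) ⟩
  V.map (c₀ *_) y +ᵥ lincomb c P ∎
  where open ≡-Reasoning

colSums-matMul-∷ : ∀ {a} (c : Vec ℕ K) (M : Vec (Vec ℕ K) a) (P : Vec (Mono d) K) →
  colSums (matMul (c V.∷ M) P) ≡ lincomb c P +ᵥ colSums (matMul M P)
colSums-matMul-∷ c M P = trans (tabulate-+ _ _)
  (cong (_+ᵥ colSums (matMul M P)) (trans (V.tabulate-cong (V.lookup∘tabulate _)) (lincomb-tabulate c P)))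

colSums-matMul-zero-rows : ∀ N (M : WithRowSums K (pad N [])) (P : Vec (Mono d) K) →
                           colSums (matMul (proj₁ M) P) ≡ 0ᵥ
colSums-matMul-zero-rows zero    (V.[] , _)       P = Equivalence.from (tabulate-≡-0ᵥ _) (λ _ → refl)
colSums-matMul-zero-rows (suc N) ((c V.∷ M) , eq) P = begin
  colSums (matMul (c V.∷ M) P)
    ≡⟨ colSums-matMul-∷ c M P ⟩
  lincomb c P +ᵥ colSums (matMul M P)
    ≡⟨ cong₂ _+ᵥ_ (trans (cong (λ c → lincomb c P) (sum≡0⇒≡0ᵥ c (V.∷-injectiveˡ eq))) (lincomb-0ᵥ P))
                  (colSums-matMul-zero-rows N (M , V.∷-injectiveʳ eq) P) ⟩
  0ᵥ +ᵥ 0ᵥ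
    ≡⟨ +ᵥ-identityˡ 0ᵥ ⟩
  0ᵥ ∎
  where open ≡-Reasoning

lists-hλPleth : ∀ lam N → length lam ≤ N → (P : Vec (Mono d) K) →
  Lists (hλPleth lam (V.toList P)) {WithRowSums K (pad N lam)} (λ M → colSums (matMul (proj₁ M) P))
lists-hλPleth []        N       _           P =
  lists-cong (λ M → sym (colSums-matMul-zero-rows N M P)) (lists-reindex (zero-rows↔⊤ N) (lists-singleton 0ᵥ))
lists-hλPleth (r ∷ lam) (suc N) (s≤s lam≤N) P =
  lists-cong (λ { ((c V.∷ M) , _) → sym (colSums-matMul-∷ c M P) })
  (lists-reindex rowSums-∷↔ (lists-*P (lists-hPleth r P) (lists-hλPleth lam N lam≤N P)))

proposition2p3 : (lam μ ν : List ℕ) (N : ℕ) → All (0 <_) lam → All (0 <_) ν → IsPartition μ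
    → length lam ≤ N → length ν ≤ N → Fin (bcoef lam μ ν) ↔ Q lam μ ν N
-- Positivity of the entries of λ and ν and the partition condition on μ are not needed.
proposition2p3 lam μ ν N _ _ _ lam≤N ν≤N with ℕ.m≤n⇒∃[o]m+o≡n ν≤N
... | k , refl = begin
  Fin (bcoef lam μ ν)
    ≡⟨ cong Fin (bcoef≡coeff-pad lam μ ν k) ⟩
  Fin (coeff (pad N′ ν) (hλPleth lam (V.toList P)))
    ↔⟨ coeff-lists (lists-hλPleth lam N′ lam≤N P) (pad N′ ν) ⟩
  Σ (WithRowSums _ (pad N′ lam)) (λ M → colSums (matMul (proj₁ M) P) ≡ pad N′ ν)
    ↔⟨ Σ-assoc ⟩
  Q lam μ ν N′ ∎
  where
  open EquationalReasoning
  N′ = length ν + k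
  P  = Pmat μ N′
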